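{- Let $G=(V,E)$ be a finite simple connected graph, let $u_1\in V$ and let $u_2\notin V$ be a new vertex. Let $G_{out}=(V\cup\{u_2\},E\cup\{\{u_1,u_2\}\})$. If $G$ is not separable, then $G_{out}$ is not separable.
   Context: A graph $G=(V,E)$ is separable if there exist non-negative real weights $w(e)$, $e\in E$, and a threshold $\alpha\in\mathbb{R}$ such that for every $E'\subseteq E$: $\sum_{e\in E'}w(e)\ge\alpha$ if and only if the spanning subgraph $(V,E')$ is connected.
   Formalization: The weights $w(e)$ and the threshold $\alpha$ that define separability are taken in ℚ instead of ℝ. -}

module Defs where

open import Data.Nat using (ℕ; zero; suc)
open import Data.Fin using (Fin; zero; suc; inject₁; fromℕ; _<_)
open import Data.Fin.Subset using (Subset)
open import Data.Vec using (lookup)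
open import Data.Bool using (Bool; true; false; if_then_else_)
open import Data.Product using (_×_; _,_; proj₁; proj₂; Σ; ∃)
open import Data.Rational using (ℚ; 0ℚ; _+_; _≤_)
open import Function.Definitions using (Injective)
open import Relation.Binary.PropositionalEquality using (_≡_)

Graph : ℕ → ℕ → Set
Graph n m = Fin m → Fin n × Fin n

-- Simple: no loops, endpoints stored in canonical order a < b,
-- and distinct edge indices give distinct edges (no multi-edges).
IsSimple : ∀ {n m} → Graph n m → Set
IsSimple {n} {m} G =
  ((e : Fin m) → proj₁ (G e) < proj₂ (G e)) × Injective _≡_ _≡_ G

data Reach {n m} (G : Graph n m) (E' : Subset m) (x : Fin n) : Fin n → Set where
  here : Reach G E' x x
  fwd  : (e : Fin m) → lookup E' e ≡ true →
         Reach G E' x (proj₁ (G e)) → Reach G E' x (proj₂ (G e))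
  bwd  : (e : Fin m) → lookup E' e ≡ true →
         Reach G E' x (proj₂ (G e)) → Reach G E' x (proj₁ (G e))

ConnectedSub : ∀ {n m} → Graph n m → Subset m → Set
ConnectedSub {n} G E' = (x y : Fin n) → Reach G E' x y

allEdges : ∀ m → Subset m
allEdges zero = Data.Vec.[]
allEdges (suc m) = true Data.Vec.∷ allEdges m

Connected : ∀ {n m} → Graph n m → Set
Connected {m = m} G = ConnectedSub G (allEdges m)

sumFin : ∀ m → (Fin m → ℚ) → ℚ
sumFin zero f = 0ℚ
sumFin (suc m) f = f zero + sumFin m (λ i → f (suc i))

weight : ∀ {m} → (Fin m → ℚ) → Subset m → ℚ
weight {m} w E' = sumFin m (λ e → if lookup E' e then w e else 0ℚ)

Separable : ∀ {n m} → Graph n m → Set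
Separable {n} {m} G =
  Σ (Fin m → ℚ) λ w → ((e : Fin m) → 0ℚ ≤ w e) ×
  Σ ℚ λ α → (E' : Subset m) →
    ((α ≤ weight w E' → ConnectedSub G E') × (ConnectedSub G E' → α ≤ weight w E'))

-- G_out: add the new vertex u₂ = fromℕ n (index n, not in V = Fin n)
-- and the new edge {u₁ , u₂} (edge index zero); old edges keep
-- their endpoints (via inject₁) and are shifted to indices suc e.
Gout : ∀ {n m} → Graph n m → Fin n → Graph (suc n) (suc m)
Gout {n} G u₁ zero = inject₁ u₁ , fromℕ n
Gout G u₁ (suc e) = inject₁ (proj₁ (G e)) , inject₁ (proj₂ (G e))

{-# OPTIONS --safe #-}
-- An edge set E' ∪ {u₁u₂} connects G_out exactly when E' connects G: walks in G embed
-- into G_out, and contracting the pendant edge maps walks in G_out back to G. Hence if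
-- weights w and a threshold α separate G_out, the weights of the old edges with the
-- threshold α − w(u₁u₂) separate G.
module Submission where

open import Defs
open import Data.Nat using (ℕ)
open import Data.Fin using (Fin; zero; suc; inject₁; fromℕ)
open import Data.Fin.Subset using (Subset)
open import Data.Fin.Relation.Unary.Top using (view; ‵fromℕ; ‵inject₁; view-fromℕ; view-inject₁)
open import Data.Vec using (lookup; _∷_)
open import Data.Bool using (true)
open import Data.Product using (_,_; proj₁; proj₂)
open import Data.Rational using (ℚ; _+_; -_; _≤_)
open import Data.Rational.Properties using (+-0-group; +-monoʳ-≤)
open import Algebra.Properties.Group +-0-group using (\\-leftDividesˡ; \\-leftDividesʳ)
open import Relation.Nullary using (¬_)
open import Relation.Binary.PropositionalEquality using (_≡_; refl; sym; subst; subst₂)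

module _ {n m : ℕ} {G : Graph n m} {E : Subset m} where

  Reach-trans : ∀ {x y z} → Reach G E x y → Reach G E y z → Reach G E x z
  Reach-trans r here         = r
  Reach-trans r (fwd e eq s) = fwd e eq (Reach-trans r s)
  Reach-trans r (bwd e eq s) = bwd e eq (Reach-trans r s)

  Reach-sym : ∀ {x y} → Reach G E x y → Reach G E y x
  Reach-sym here         = here
  Reach-sym (fwd e eq r) = Reach-trans (bwd e eq here) (Reach-sym r)
  Reach-sym (bwd e eq r) = Reach-trans (fwd e eq here) (Reach-sym r)

Reach-map : ∀ {n m n′ m′} {G : Graph n m} {E : Subset m} {G′ : Graph n′ m′} {E′ : Subset m′}
  (f : Fin n → Fin n′) →
  (∀ e → lookup E e ≡ true → Reach G′ E′ (f (proj₁ (G e))) (f (proj₂ (G e)))) →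
  ∀ {x y} → Reach G E x y → Reach G′ E′ (f x) (f y)
Reach-map f edge here         = here
Reach-map f edge (fwd e eq r) = Reach-trans (Reach-map f edge r) (edge e eq)
Reach-map f edge (bwd e eq r) = Reach-trans (Reach-map f edge r) (Reach-sym (edge e eq))

contractTo : ∀ {n} → Fin n → Fin (ℕ.suc n) → Fin n
contractTo u i with view i
... | ‵fromℕ      = u
... | ‵inject₁ j  = j

contractTo-fromℕ : ∀ {n} (u : Fin n) → contractTo u (fromℕ n) ≡ u
contractTo-fromℕ {n} u rewrite view-fromℕ n = refl

contractTo-inject₁ : ∀ {n} (u j : Fin n) → contractTo u (inject₁ j) ≡ j
contractTo-inject₁ u j rewrite view-inject₁ j = refl

module _ {n m : ℕ} (G : Graph n m) (u : Fin n) (E : Subset m) where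

  Reach-inject₁ : ∀ {x y} → Reach G E x y →
                  Reach (Gout G u) (true ∷ E) (inject₁ x) (inject₁ y)
  Reach-inject₁ = Reach-map inject₁ (λ e eq → fwd (suc e) eq here)

  Reach-contractTo : ∀ {x y} → Reach (Gout G u) (true ∷ E) x y →
                     Reach G E (contractTo u x) (contractTo u y)
  Reach-contractTo = Reach-map (contractTo u) edge
    where
    edge : ∀ e → lookup (true ∷ E) e ≡ true →
           Reach G E (contractTo u (proj₁ (Gout G u e))) (contractTo u (proj₂ (Gout G u e)))
    edge zero    _  = subst₂ (Reach G E) (sym (contractTo-inject₁ u u))
                                         (sym (contractTo-fromℕ u)) here
    edge (suc e) eq = subst₂ (Reach G E) (sym (contractTo-inject₁ u _))
                                         (sym (contractTo-inject₁ u _)) (fwd e eq here)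

  ConnectedSub-Gout⇒ConnectedSub : ConnectedSub (Gout G u) (true ∷ E) → ConnectedSub G E
  ConnectedSub-Gout⇒ConnectedSub c x y =
    subst₂ (Reach G E) (contractTo-inject₁ u x) (contractTo-inject₁ u y)
      (Reach-contractTo (c (inject₁ x) (inject₁ y)))

  ConnectedSub⇒ConnectedSub-Gout : ConnectedSub G E → ConnectedSub (Gout G u) (true ∷ E)
  ConnectedSub⇒ConnectedSub-Gout c x y = Reach-trans (Reach-sym (from-u x)) (from-u y)
    where
    from-u : ∀ v → Reach (Gout G u) (true ∷ E) (inject₁ u) v
    from-u v with view v
    ... | ‵fromℕ     = fwd zero refl here
    ... | ‵inject₁ j = Reach-inject₁ (c u j)

-+-≤⇒≤+ : ∀ c {a s : ℚ} → - c + a ≤ s → a ≤ c + s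
-+-≤⇒≤+ c {a} le = subst (_≤ c + _) (\\-leftDividesˡ c a) (+-monoʳ-≤ c le)

≤+⇒-+-≤ : ∀ c {a s : ℚ} → a ≤ c + s → - c + a ≤ s
≤+⇒-+-≤ c {s = s} le = subst (- c + _ ≤_) (\\-leftDividesʳ c s) (+-monoʳ-≤ (- c) le)

Separable-Gout⇒Separable : ∀ {n m} (G : Graph n m) (u : Fin n) →
                           Separable (Gout G u) → Separable G
-- weight w (true ∷ E) reduces to w zero + weight (w ∘ suc) E, so sep can be used directly.
Separable-Gout⇒Separable G u (w , w≥0 , α , sep) =
  (λ e → w (suc e)) , (λ e → w≥0 (suc e)) , - w zero + α , λ E → below E , above E
  where
  below : ∀ E → - w zero + α ≤ weight (λ e → w (suc e)) E → ConnectedSub G E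
  below E le = ConnectedSub-Gout⇒ConnectedSub G u E
                 (proj₁ (sep (true ∷ E)) (-+-≤⇒≤+ (w zero) le))

  above : ∀ E → ConnectedSub G E → - w zero + α ≤ weight (λ e → w (suc e)) E
  above E c = ≤+⇒-+-≤ (w zero)
                (proj₂ (sep (true ∷ E)) (ConnectedSub⇒ConnectedSub-Gout G u E c))

lemma1 : (n m : ℕ) (G : Graph n m) → IsSimple G → Connected G →
    (u₁ : Fin n) → ¬ Separable G → ¬ Separable (Gout G u₁)
lemma1 n m G _ _ u₁ ¬sep sep = ¬sep (Separable-Gout⇒Separable G u₁ sep)
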